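{- Let $\lambda \geq 1$ be an integer, let $c_1, \dots, c_d$ be non-negative cost functions on a finite set containing $S$, and assume that $c_i(S) > 1$ for some $1 \leq i \leq d$ and that $\max_{1 \leq i \leq d} c_i(u) \leq \lambda^{ -1}$ for every $u \in S$. Then the output set $T$ of the procedure SetExtract$(\lambda, S)$ is a subset of $S$ such that $\max_{1 \leq i \leq d} c_i(T) \leq 1$ and $\sum_{i=1}^d c_i(T) \geq \frac{\lambda}{\lambda+1}$.
   Context: $c_i(X) = \sum_{u \in X} c_i(u)$. Procedure SetExtract$(\lambda, S)$: for $j = 1, \dots, \lambda + 1$: initialize $T_j = \{u_1, \dots, u_{j-1}\}$; then scan the elements $u \in S$ in an arbitrary order, and for each, if $\max_{1 \leq i \leq d} c_i(T_j \cup \{u\}) \leq 1$ add $u$ to $T_j$, and otherwise denote this element by $u_j$ and stop the scan. Finally return the set maximizing $\sum_{i=1}^d c_i(T)$ among $T \in \{T_1, \dots, T_{\lambda+1}\}$.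
   Formalization: The cost functions $c_1, \dots, c_d$ take non-negative rational values rather than real ones. -}

module Defs where

open import Data.Nat using (ℕ; zero; suc)
open import Data.Bool using (Bool; true; false; if_then_else_)
open import Data.Fin using (Fin)
open import Data.Fin.Subset using (Subset; _∈_; _∪_; ⁅_⁆; ⊥)
open import Data.Vec using (lookup)
open import Data.List using (List; []; _∷_; map; foldr; allFin)
open import Data.Bool.ListAction using (and)
open import Data.List.Relation.Unary.Unique.Propositional using (Unique)
import Data.List.Membership.Propositional as LM
open import Data.Maybe using (Maybe; just; nothing)
open import Data.Product using (_×_; _,_)
open import Function.Bundles using (_⇔_)
open import Data.Rational using (ℚ; 0ℚ; 1ℚ; _+_; _≤?_)
open import Relation.Nullary using (does)

sumℚ : List ℚ → ℚ
sumℚ = foldr _+_ 0ℚ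

cost : ∀ {d n} → (Fin d → Fin n → ℚ) → Fin d → Subset n → ℚ
cost {n = n} c i X = sumℚ (map (λ u → if lookup X u then c i u else 0ℚ) (allFin n))

totalCost : ∀ {d n} → (Fin d → Fin n → ℚ) → Subset n → ℚ
totalCost {d = d} c X = sumℚ (map (λ i → cost c i X) (allFin d))

fits : ∀ {d n} → (Fin d → Fin n → ℚ) → Subset n → Bool
fits {d = d} c X = and (map (λ i → does (cost c i X ≤? 1ℚ)) (allFin d))

-- one scan: starting from T, scan the list; add u if T ∪ {u} still fits,
-- otherwise stop and report u (the element u_j).  nothing = scan finished.
scan : ∀ {d n} → (Fin d → Fin n → ℚ) → Subset n → List (Fin n) → Subset n × Maybe (Fin n)
scan c T [] = T , nothing
scan c T (u ∷ us) with fits c (T ∪ ⁅ u ⁆)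
... | true  = scan c (T ∪ ⁅ u ⁆) us
... | false = T , just u

-- rounds j, j+1, ..., j+k-1; P = {u_1, ..., u_{j-1}}; ord j = scan order used in round j.
-- (If a scan never stops, u_j is undefined; this cannot happen under the
--  hypotheses of the lemma, and we then simply leave P unchanged.)
rounds : ∀ {d n} → (Fin d → Fin n → ℚ) → (ℕ → List (Fin n)) → ℕ → ℕ → Subset n → List (Subset n)
rounds c ord zero    j P = []
rounds c ord (suc k) j P with scan c P (ord j)
... | T , just u  = T ∷ rounds c ord k (suc j) (P ∪ ⁅ u ⁆)
... | T , nothing = T ∷ rounds c ord k (suc j) P

candidates : ∀ {d n} → (Fin d → Fin n → ℚ) → (ℕ → List (Fin n)) → ℕ → List (Subset n)
candidates {n = n} c ord lam = rounds c ord (suc lam) 1 ⊥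

Enumerates : ∀ {n} → Subset n → List (Fin n) → Set
Enumerates S l = Unique l × (∀ u → (u ∈ S) ⇔ (u LM.∈ l))

{-# OPTIONS --safe #-}
module Submission where

-- Round j ≤ λ+1 starts from P = {u₁,…,u_{j-1}}, whose costs are at
-- most (j-1)/λ ≤ 1; so P fits, and so does T_j ⊇ P. As c_i(S) > 1 for some i,
-- the scan cannot absorb all of S: it stops at some u_j ∉ T_j with
-- c_i(T_j) + c_i(u_j) > 1 for some i. Writing c(X) = Σ_i c_i(X) and using
-- c(P_{j+1}) = c(P_j) + c(u_j), this gives c(T_j) ≥ 1 - (c(P_{j+1}) - c(P_j))
-- for j ≤ λ, while c(T_{λ+1}) ≥ c(P_{λ+1}). The sum telescopes to
-- Σ_j c(T_j) ≥ λ, so the best of the λ+1 candidates has c(T) ≥ λ/(λ+1).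

open import Defs
open import Data.Nat using (ℕ; suc; NonZero)
open import Data.Fin using (Fin)
open import Data.Fin.Subset using (Subset; _∈_; _⊆_)
open import Data.List using (List)
open import Data.List.Membership.Propositional renaming (_∈_ to _∈ₗ_)
open import Data.Product using (_×_; ∃)
open import Data.Integer using (+_)
open import Data.Rational using (ℚ; 0ℚ; 1ℚ; _≤_; _<_; _/_)

open import Algebra.Bundles using (CommutativeMonoid)
open import Data.Bool using (Bool; T; true; false; if_then_else_; _∨_)
open import Data.Bool.Properties using (T-≡)
open import Data.Empty using (⊥-elim)
open import Data.Fin using (zero; suc)
open import Data.Nat using (zero)
open import Data.Fin.Properties using (¬∀⟶∃¬)
open import Data.Fin.Subset using (_∪_; ⁅_⁆; ⊥)
open import Data.Fin.Subset.Properties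
  using (⊥⊆; drop-∷-⊆; x∈⁅x⁆; x∈⁅y⁆⇒x≡y; x∈p∪q⁻; p⊆p∪q; q⊆p∪q; ⊆-trans)
import Data.Integer as ℤ
import Data.Integer.Properties as ℤ
import Data.Integer.Solver as ℤ
open import Data.List using ([]; _∷_; map; length; allFin)
open import Data.List.Membership.Propositional.Properties using (∈-allFin)
open import Data.List.Properties using (map-cong; map-tabulate)
open import Data.List.Relation.Unary.All using (All; []; _∷_)
import Data.List.Relation.Unary.All as All
open import Data.List.Relation.Unary.All.Properties using (all⁺; all⁻)
open import Data.List.Relation.Unary.Any using (here; there)
open import Data.Maybe using (just; nothing)
open import Data.Sum using (inj₁; inj₂)
import Data.Nat as ℕ
import Data.Nat.Solver as ℕ
open import Data.Product using (_,_; proj₁; proj₂; map₁; map₂)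
open import Data.Rational using (_+_; _≤?_; toℚᵘ; +-0-rawMonoid)
open import Data.Rational.Properties
  using ( ≤-refl; ≤-reflexive; ≤-trans; <⇒≤; <-irrefl; <-≤-trans; ≮⇒≥; ≰⇒>
        ; +-assoc; +-identityˡ; +-identityʳ; +-mono-≤; +-monoˡ-≤; +-monoʳ-≤; +-mono-<-≤
        ; +-0-commutativeMonoid; nonNegative⁻¹; normalize-nonNeg
        ; toℚᵘ-injective; toℚᵘ-fromℚᵘ; toℚᵘ-homo-+; module ≤-Reasoning )
open import Data.Rational.Unnormalised using (mkℚᵘ; *≡*; _≃_)
import Data.Rational.Unnormalised as ℚᵘ
import Data.Rational.Unnormalised.Properties as ℚᵘ
open import Data.Vec using ([]; _∷_)
import Data.Vec as Vec
open import Function using (_∘_; id)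
open import Function.Bundles using (Equivalence)
open import Relation.Binary.PropositionalEquality
open import Relation.Nullary using (¬_; contradiction; does)
open import Relation.Nullary.Decidable using (dec-true; dec-false; decidable-stable)

open import Algebra.Definitions.RawMonoid +-0-rawMonoid using () renaming (_×_ to _·_)
open import Algebra.Properties.CommutativeSemigroup
  (CommutativeMonoid.commutativeSemigroup +-0-commutativeMonoid)
  using (interchange; xy∙z≈x∙zy; xy∙z≈y∙xz; x∙yz≈y∙xz)

mkℚᵘ-+ : ∀ i j b → mkℚᵘ i b ℚᵘ.+ mkℚᵘ j b ≃ mkℚᵘ (i ℤ.+ j) b
mkℚᵘ-+ i j b = *≡* (begin
  (i ℤ.* s ℤ.+ j ℤ.* s) ℤ.* s        ≡⟨ solve 3 (λ i j s → (i :* s :+ j :* s) :* s := (i :+ j) :* (s :* s)) refl i j s ⟩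
  (i ℤ.+ j) ℤ.* (s ℤ.* s)            ≡⟨ cong ((i ℤ.+ j) ℤ.*_) (ℤ.pos-* (suc b) (suc b)) ⟨
  (i ℤ.+ j) ℤ.* + (suc b ℕ.* suc b)  ∎)
  where
  open ≡-Reasoning
  open ℤ.+-*-Solver
  s = + suc b

toℚᵘ-·-/ : ∀ k a b → toℚᵘ (k · (+ a / suc b)) ≃ mkℚᵘ (+ (k ℕ.* a)) b
toℚᵘ-·-/ zero    a b = *≡* refl
toℚᵘ-·-/ (suc k) a b = begin
  toℚᵘ (+ a / suc b + k · (+ a / suc b))             ≈⟨ toℚᵘ-homo-+ (+ a / suc b) (k · (+ a / suc b)) ⟩
  toℚᵘ (+ a / suc b) ℚᵘ.+ toℚᵘ (k · (+ a / suc b))   ≈⟨ ℚᵘ.+-cong (toℚᵘ-fromℚᵘ (mkℚᵘ (+ a) b)) (toℚᵘ-·-/ k a b) ⟩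
  mkℚᵘ (+ a) b ℚᵘ.+ mkℚᵘ (+ (k ℕ.* a)) b             ≈⟨ mkℚᵘ-+ (+ a) (+ (k ℕ.* a)) b ⟩
  mkℚᵘ (+ (suc k ℕ.* a)) b                           ∎
  where open ℚᵘ.≃-Reasoning

·-/-cancel : ∀ n a .{{_ : NonZero n}} → n · (+ a / n) ≡ a · 1ℚ
·-/-cancel (suc b) a = toℚᵘ-injective (begin
  toℚᵘ (suc b · (+ a / suc b))  ≈⟨ toℚᵘ-·-/ (suc b) a b ⟩
  mkℚᵘ (+ (suc b ℕ.* a)) b      ≈⟨ *≡* cross-multiplied ⟩
  mkℚᵘ (+ (a ℕ.* 1)) 0          ≈⟨ toℚᵘ-·-/ a 1 0 ⟨
  toℚᵘ (a · 1ℚ)                 ∎)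
  where
  open ℚᵘ.≃-Reasoning
  cross-multiplied : + (suc b ℕ.* a) ℤ.* + 1 ≡ + (a ℕ.* 1) ℤ.* + suc b
  cross-multiplied = trans (sym (ℤ.pos-* (suc b ℕ.* a) 1))
    (trans (cong +_ (solve 2 (λ a b → (con 1 :+ b) :* a :* con 1 := a :* con 1 :* (con 1 :+ b)) refl a b))
           (ℤ.pos-* (a ℕ.* 1) (suc b)))
    where open ℕ.+-*-Solver

·-nonNeg : ∀ n {x} → 0ℚ ≤ x → 0ℚ ≤ n · x
·-nonNeg zero    _   = ≤-refl
·-nonNeg (suc n) 0≤x = +-mono-≤ 0≤x (·-nonNeg n 0≤x)

·-monoʳ-≤ : ∀ n {x y} → x ≤ y → n · x ≤ n · y
·-monoʳ-≤ zero    _   = ≤-refl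
·-monoʳ-≤ (suc n) x≤y = +-mono-≤ x≤y (·-monoʳ-≤ n x≤y)

·-monoʳ-< : ∀ n .{{_ : NonZero n}} {x y} → x < y → n · x < n · y
·-monoʳ-< (suc n) x<y = +-mono-<-≤ x<y (·-monoʳ-≤ n (<⇒≤ x<y))

·-cancelʳ-≤ : ∀ n .{{_ : NonZero n}} {x y} → n · x ≤ n · y → x ≤ y
·-cancelʳ-≤ n nx≤ny = ≮⇒≥ (λ y<x → <-irrefl refl (<-≤-trans (·-monoʳ-< n y<x) nx≤ny))

module _ {a} {A : Set a} where

  sumℚ-map-+ : ∀ (f g : A → ℚ) xs → sumℚ (map (λ x → f x + g x) xs) ≡ sumℚ (map f xs) + sumℚ (map g xs)
  sumℚ-map-+ f g []       = refl
  sumℚ-map-+ f g (x ∷ xs) = trans (cong (_+_ (f x + g x)) (sumℚ-map-+ f g xs)) (interchange (f x) (g x) _ _)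

  sumℚ-map-mono : ∀ {f g : A → ℚ} → (∀ x → f x ≤ g x) → ∀ xs → sumℚ (map f xs) ≤ sumℚ (map g xs)
  sumℚ-map-mono f≤g []       = ≤-refl
  sumℚ-map-mono f≤g (x ∷ xs) = +-mono-≤ (f≤g x) (sumℚ-map-mono f≤g xs)

  sumℚ-map-nonNeg : ∀ {f : A → ℚ} → (∀ x → 0ℚ ≤ f x) → ∀ xs → 0ℚ ≤ sumℚ (map f xs)
  sumℚ-map-nonNeg f≥0 []       = ≤-refl
  sumℚ-map-nonNeg f≥0 (x ∷ xs) = +-mono-≤ (f≥0 x) (sumℚ-map-nonNeg f≥0 xs)

  ≤-sumℚ-map : ∀ {f : A → ℚ} → (∀ x → 0ℚ ≤ f x) → ∀ {x xs} → x ∈ₗ xs → f x ≤ sumℚ (map f xs)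
  ≤-sumℚ-map {f} f≥0 {xs = x ∷ xs} (here refl) = begin
    f x                    ≡⟨ +-identityʳ (f x) ⟨
    f x + 0ℚ               ≤⟨ +-monoʳ-≤ (f x) (sumℚ-map-nonNeg f≥0 xs) ⟩
    f x + sumℚ (map f xs)  ∎
    where open ≤-Reasoning
  ≤-sumℚ-map {f} f≥0 {x} {y ∷ xs} (there x∈xs) = begin
    f x                    ≤⟨ ≤-sumℚ-map f≥0 x∈xs ⟩
    sumℚ (map f xs)        ≡⟨ +-identityˡ _ ⟨
    0ℚ + sumℚ (map f xs)   ≤⟨ +-monoˡ-≤ (sumℚ (map f xs)) (f≥0 y) ⟩
    f y + sumℚ (map f xs)  ∎
    where open ≤-Reasoning

  sumℚ-map-≤-length· : ∀ {f : A → ℚ} {M xs} → All (λ x → f x ≤ M) xs → sumℚ (map f xs) ≤ length xs · M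
  sumℚ-map-≤-length· []           = ≤-refl
  sumℚ-map-≤-length· (fx≤M ∷ f≤M) = +-mono-≤ fx≤M (sumℚ-map-≤-length· f≤M)

∪-⁅⁆-⊆ : ∀ {n} {X Y : Subset n} {u} → X ⊆ Y → u ∈ Y → X ∪ ⁅ u ⁆ ⊆ Y
∪-⁅⁆-⊆ {X = X} {u = u} X⊆Y u∈Y v∈X∪u with x∈p∪q⁻ X ⁅ u ⁆ v∈X∪u
... | inj₁ v∈X = X⊆Y v∈X
... | inj₂ v∈u rewrite x∈⁅y⁆⇒x≡y u v∈u = u∈Y

disjoint-⁅⁆ : ∀ {n} {X : Subset n} {u} → ¬ u ∈ X → ∀ {v} → v ∈ X → ¬ v ∈ ⁅ u ⁆
disjoint-⁅⁆ {u = u} u∉X v∈X v∈⁅u⁆ rewrite x∈⁅y⁆⇒x≡y u v∈⁅u⁆ = u∉X v∈X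

module _ {d : ℕ} where

  shift : ∀ {n} → (Fin d → Fin (suc n) → ℚ) → Fin d → Fin n → ℚ
  shift c i u = c i (suc u)

  cost-∷ : ∀ {n} (c : Fin d → Fin (suc n) → ℚ) i b (X : Subset n) →
           cost c i (b ∷ X) ≡ (if b then c i zero else 0ℚ) + cost (shift c) i X
  cost-∷ c i b X = cong (_+_ (f zero)) (cong sumℚ (trans (map-tabulate suc f) (sym (map-tabulate id (f ∘ suc)))))
    where f = λ u → if Vec.lookup (b ∷ X) u then c i u else 0ℚ

  cost-⊥ : ∀ {n} (c : Fin d → Fin n → ℚ) i → cost c i ⊥ ≡ 0ℚ
  cost-⊥ {zero}  c i = refl
  cost-⊥ {suc n} c i = trans (cost-∷ c i false ⊥) (cong (_+_ 0ℚ) (cost-⊥ (shift c) i))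

  cost-⁅⁆ : ∀ {n} (c : Fin d → Fin n → ℚ) i u → cost c i ⁅ u ⁆ ≡ c i u
  cost-⁅⁆ c i zero    = trans (cost-∷ c i true ⊥) (trans (cong (_+_ (c i zero)) (cost-⊥ (shift c) i)) (+-identityʳ _))
  cost-⁅⁆ c i (suc u) = trans (cost-∷ c i false ⁅ u ⁆) (trans (+-identityˡ _) (cost-⁅⁆ (shift c) i u))

  cost-mono : ∀ {n} (c : Fin d → Fin n → ℚ) i → (∀ u → 0ℚ ≤ c i u) →
              ∀ {X Y} → X ⊆ Y → cost c i X ≤ cost c i Y
  cost-mono c i c≥0 {[]}    {[]}    _   = ≤-refl
  cost-mono c i c≥0 {a ∷ X} {b ∷ Y} X⊆Y = begin
    cost c i (a ∷ X)                              ≡⟨ cost-∷ c i a X ⟩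
    (if a then c i zero else 0ℚ) + cost (shift c) i X
      ≤⟨ +-mono-≤ (head a b λ { refl → X⊆Y Vec.here }) (cost-mono (shift c) i (c≥0 ∘ suc) (drop-∷-⊆ X⊆Y)) ⟩
    (if b then c i zero else 0ℚ) + cost (shift c) i Y ≡⟨ cost-∷ c i b Y ⟨
    cost c i (b ∷ Y)                              ∎
    where
    open ≤-Reasoning
    head : ∀ a b → (a ≡ true → zero ∈ b ∷ Y) → (if a then c i zero else 0ℚ) ≤ (if b then c i zero else 0ℚ)
    head true  true  _   = ≤-refl
    head true  false a⊆b with () ← a⊆b refl
    head false true  _   = c≥0 zero
    head false false _   = ≤-refl

  cost-nonNeg : ∀ {n} (c : Fin d → Fin n → ℚ) i → (∀ u → 0ℚ ≤ c i u) → ∀ X → 0ℚ ≤ cost c i X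
  cost-nonNeg c i c≥0 X = subst (_≤ cost c i X) (cost-⊥ c i) (cost-mono c i c≥0 {Y = X} ⊥⊆)

  cost-∪ : ∀ {n} (c : Fin d → Fin n → ℚ) i {X Y} → (∀ {u} → u ∈ X → ¬ u ∈ Y) →
           cost c i (X ∪ Y) ≡ cost c i X + cost c i Y
  cost-∪ c i {[]}    {[]}    _      = refl
  cost-∪ c i {a ∷ X} {b ∷ Y} X∩Y≡∅ = begin
    cost c i ((a ∷ X) ∪ (b ∷ Y))                                ≡⟨ cost-∷ c i (a ∨ b) (X ∪ Y) ⟩
    at (a ∨ b) + cost (shift c) i (X ∪ Y)
      ≡⟨ cong₂ _+_ (head a b λ { refl refl → X∩Y≡∅ Vec.here Vec.here })
                   (cost-∪ (shift c) i λ u∈X u∈Y → X∩Y≡∅ (Vec.there u∈X) (Vec.there u∈Y)) ⟩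
    (at a + at b) + (cost (shift c) i X + cost (shift c) i Y)   ≡⟨ interchange (at a) (at b) _ _ ⟩
    (at a + cost (shift c) i X) + (at b + cost (shift c) i Y)   ≡⟨ cong₂ _+_ (cost-∷ c i a X) (cost-∷ c i b Y) ⟨
    cost c i (a ∷ X) + cost c i (b ∷ Y)                         ∎
    where
    open ≡-Reasoning
    at : Bool → ℚ
    at b = if b then c i zero else 0ℚ
    head : ∀ a b → (a ≡ true → b ≢ true) → at (a ∨ b) ≡ at a + at b
    head true  true  a∩b≡∅ = ⊥-elim (a∩b≡∅ refl refl)
    head true  false _     = sym (+-identityʳ _)
    head false true  _     = sym (+-identityˡ _)
    head false false _     = refl

module _ {d n : ℕ} (c : Fin d → Fin n → ℚ) where

  totalCost-∪ : ∀ {X Y} → (∀ {u} → u ∈ X → ¬ u ∈ Y) → totalCost c (X ∪ Y) ≡ totalCost c X + totalCost c Y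
  totalCost-∪ {X} {Y} X∩Y≡∅ = trans (cong sumℚ (map-cong (λ i → cost-∪ c i {X} {Y} X∩Y≡∅) (allFin d)))
                                    (sumℚ-map-+ (λ i → cost c i X) (λ i → cost c i Y) (allFin d))

  Fits : Subset n → Set
  Fits X = ∀ i → cost c i X ≤ 1ℚ

  fits⇒Fits : ∀ {X} → fits c X ≡ true → Fits X
  fits⇒Fits {X} e i = decidable-stable (cost c i X ≤? 1ℚ) λ x≰1 →
    subst T (dec-false (cost c i X ≤? 1ℚ) x≰1) (All.lookup (all⁺ _ (allFin d) (Equivalence.from T-≡ e)) (∈-allFin i))

  Fits⇒fits : ∀ {X} → Fits X → fits c X ≡ true
  Fits⇒fits {X} X-fits = Equivalence.to T-≡ (all⁻ (λ i → does (cost c i X ≤? 1ℚ)) {allFin d}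
    (All.tabulate λ {i} _ → Equivalence.from T-≡ (dec-true (cost c i X ≤? 1ℚ) (X-fits i))))

  fits≡false⇒overflow : ∀ {X} → fits c X ≡ false → ∃ λ i → 1ℚ < cost c i X
  fits≡false⇒overflow {X} e = map₂ ≰⇒> (¬∀⟶∃¬ d (λ i → cost c i X ≤ 1ℚ) (λ i → cost c i X ≤? 1ℚ) X-unfit)
    where
    X-unfit : ¬ Fits X
    X-unfit X-fits with () ← trans (sym e) (Fits⇒fits {X} X-fits)

  module _ (c≥0 : ∀ i u → 0ℚ ≤ c i u) where

    totalCost-mono : ∀ {X Y} → X ⊆ Y → totalCost c X ≤ totalCost c Y
    totalCost-mono X⊆Y = sumℚ-map-mono (λ i → cost-mono c i (c≥0 i) X⊆Y) (allFin d)

    totalCost-nonNeg : ∀ X → 0ℚ ≤ totalCost c X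
    totalCost-nonNeg X = sumℚ-map-nonNeg (λ i → cost-nonNeg c i (c≥0 i) X) (allFin d)

    cost≤totalCost : ∀ i X → cost c i X ≤ totalCost c X
    cost≤totalCost i X = ≤-sumℚ-map (λ i → cost-nonNeg c i (c≥0 i) X) (∈-allFin i)

    Fits-anti : ∀ {X Y} → X ⊆ Y → Fits Y → Fits X
    Fits-anti X⊆Y Y-fits i = ≤-trans (cost-mono c i (c≥0 i) X⊆Y) (Y-fits i)

    overflow⇒∉ : ∀ {X u i} → Fits X → 1ℚ < cost c i (X ∪ ⁅ u ⁆) → ¬ u ∈ X
    overflow⇒∉ {i = i} X-fits overflow u∈X =
      <-irrefl refl (<-≤-trans overflow (Fits-anti (∪-⁅⁆-⊆ id u∈X) X-fits i))

    overflow⇒1≤totalCost : ∀ {X u i} → ¬ u ∈ X → 1ℚ < cost c i (X ∪ ⁅ u ⁆) →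
                           1ℚ ≤ totalCost c X + totalCost c ⁅ u ⁆
    overflow⇒1≤totalCost {X} {u} {i} u∉X overflow = begin
      1ℚ                                 ≤⟨ <⇒≤ overflow ⟩
      cost c i (X ∪ ⁅ u ⁆)               ≡⟨ cost-∪ c i (disjoint-⁅⁆ u∉X) ⟩
      cost c i X + cost c i ⁅ u ⁆        ≤⟨ +-mono-≤ (cost≤totalCost i X) (cost≤totalCost i ⁅ u ⁆) ⟩
      totalCost c X + totalCost c ⁅ u ⁆  ∎
      where open ≤-Reasoning

  scan-⊇ : ∀ T us → T ⊆ proj₁ (scan c T us)
  scan-⊇ T []       = id
  scan-⊇ T (u ∷ us) with fits c (T ∪ ⁅ u ⁆)
  ... | true  = ⊆-trans (p⊆p∪q ⁅ u ⁆) (scan-⊇ (T ∪ ⁅ u ⁆) us)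
  ... | false = id

  scan-⊆ : ∀ {S} T us → T ⊆ S → (∀ {u} → u ∈ₗ us → u ∈ S) → proj₁ (scan c T us) ⊆ S
  scan-⊆ T []       T⊆S _    = T⊆S
  scan-⊆ T (u ∷ us) T⊆S us⊆S with fits c (T ∪ ⁅ u ⁆)
  ... | true  = scan-⊆ (T ∪ ⁅ u ⁆) us (∪-⁅⁆-⊆ T⊆S (us⊆S (here refl))) (us⊆S ∘ there)
  ... | false = T⊆S

  scan-fits : ∀ T us → Fits T → Fits (proj₁ (scan c T us))
  scan-fits T []       T-fits = T-fits
  scan-fits T (u ∷ us) T-fits with fits c (T ∪ ⁅ u ⁆) in e
  ... | true  = scan-fits (T ∪ ⁅ u ⁆) us (fits⇒Fits {T ∪ ⁅ u ⁆} e)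
  ... | false = T-fits

  scan-nothing : ∀ T us → proj₂ (scan c T us) ≡ nothing → ∀ {u} → u ∈ₗ us → u ∈ proj₁ (scan c T us)
  scan-nothing T (u ∷ us) e u∈us with fits c (T ∪ ⁅ u ⁆)
  scan-nothing T (u ∷ us) e (here refl)  | true = scan-⊇ (T ∪ ⁅ u ⁆) us (q⊆p∪q T ⁅ u ⁆ (x∈⁅x⁆ u))
  scan-nothing T (u ∷ us) e (there u∈us) | true = scan-nothing (T ∪ ⁅ u ⁆) us e u∈us
  scan-nothing T (u ∷ us) () _           | false

  scan-just : ∀ T us {u} → proj₂ (scan c T us) ≡ just u →
              u ∈ₗ us × ∃ λ i → 1ℚ < cost c i (proj₁ (scan c T us) ∪ ⁅ u ⁆)
  scan-just T (v ∷ us) e with fits c (T ∪ ⁅ v ⁆) in f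
  ... | true = map₁ there (scan-just (T ∪ ⁅ v ⁆) us e)
  scan-just T (v ∷ us) refl | false = here refl , fits≡false⇒overflow {T ∪ ⁅ v ⁆} f

  module _ (ord : ℕ → List (Fin n)) where

    length-rounds : ∀ k j P → length (rounds c ord k j P) ≡ k
    length-rounds zero    j P = refl
    length-rounds (suc k) j P with scan c P (ord j)
    ... | _ , just u  = cong suc (length-rounds k (suc j) (P ∪ ⁅ u ⁆))
    ... | _ , nothing = cong suc (length-rounds k (suc j) P)

    rounds-just : ∀ {k j P u} → proj₂ (scan c P (ord j)) ≡ just u →
                  rounds c ord (suc k) j P ≡ proj₁ (scan c P (ord j)) ∷ rounds c ord k (suc j) (P ∪ ⁅ u ⁆)
    rounds-just {k} {j} {P} e with scan c P (ord j)
    rounds-just refl | _ , just _ = refl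

module SetExtract {n d : ℕ} (lam : ℕ) .{{_ : NonZero lam}}
  (c : Fin d → Fin n → ℚ) (S : Subset n) (ord : ℕ → List (Fin n))
  (ord-enumerates : ∀ j → Enumerates S (ord j))
  (c≥0 : ∀ i u → 0ℚ ≤ c i u)
  (S-overflows : ∃ λ i → 1ℚ < cost c i S)
  (c≤ε : ∀ i u → u ∈ S → c i u ≤ + 1 / lam) where

  ε : ℚ
  ε = + 1 / lam

  ord⊆S : ∀ j {u} → u ∈ₗ ord j → u ∈ S
  ord⊆S j = Equivalence.from (proj₂ (ord-enumerates j) _)

  S⊆ord : ∀ j {u} → u ∈ S → u ∈ₗ ord j
  S⊆ord j = Equivalence.to (proj₂ (ord-enumerates j) _)

  S-unfit : ¬ Fits c S
  S-unfit S-fits = <-irrefl refl (<-≤-trans (proj₂ S-overflows) (S-fits (proj₁ S-overflows)))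

  -- In round j, P = {u₁,…,u_{j-1}} still has room for k = λ+1-j elements of S.
  Room : ℕ → Subset n → Set
  Room k P = P ⊆ S × (∀ i → cost c i P + k · ε ≤ 1ℚ)

  room-⊥ : Room lam ⊥
  room-⊥ = ⊥⊆ , λ i → ≤-reflexive (begin
    cost c i ⊥ + lam · ε  ≡⟨ cong₂ _+_ (cost-⊥ c i) (·-/-cancel lam 1) ⟩
    0ℚ + (1ℚ + 0ℚ)        ≡⟨ trans (+-identityˡ _) (+-identityʳ 1ℚ) ⟩
    1ℚ                    ∎)
    where open ≡-Reasoning

  room⇒Fits : ∀ {k P} → Room k P → Fits c P
  room⇒Fits {k} {P} (_ , room) i = begin
    cost c i P          ≡⟨ +-identityʳ _ ⟨
    cost c i P + 0ℚ     ≤⟨ +-monoʳ-≤ (cost c i P) (·-nonNeg k (nonNegative⁻¹ ε {{normalize-nonNeg 1 lam}})) ⟩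
    cost c i P + k · ε  ≤⟨ room i ⟩
    1ℚ                  ∎
    where open ≤-Reasoning

  room-∪-⁅⁆ : ∀ {k P u} → Room (suc k) P → u ∈ S → ¬ u ∈ P → Room k (P ∪ ⁅ u ⁆)
  room-∪-⁅⁆ {k} {P} {u} (P⊆S , room) u∈S u∉P = ∪-⁅⁆-⊆ P⊆S u∈S , λ i → begin
    cost c i (P ∪ ⁅ u ⁆) + k · ε           ≡⟨ cong (_+ k · ε) (cost-∪ c i (disjoint-⁅⁆ u∉P)) ⟩
    (cost c i P + cost c i ⁅ u ⁆) + k · ε  ≡⟨ cong (λ x → (cost c i P + x) + k · ε) (cost-⁅⁆ c i u) ⟩
    (cost c i P + c i u) + k · ε           ≤⟨ +-monoˡ-≤ (k · ε) (+-monoʳ-≤ (cost c i P) (c≤ε i u u∈S)) ⟩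
    (cost c i P + ε) + k · ε               ≡⟨ +-assoc (cost c i P) ε (k · ε) ⟩
    cost c i P + suc k · ε                 ≤⟨ room i ⟩
    1ℚ                                     ∎
    where open ≤-Reasoning

  scan-stops : ∀ j {P} → Fits c P → ∃ λ u → proj₂ (scan c P (ord j)) ≡ just u
  scan-stops j {P} P-fits with proj₂ (scan c P (ord j)) in e
  ... | just u  = u , refl
  ... | nothing = contradiction (Fits-anti c c≥0 S⊆T (scan-fits c P (ord j) P-fits)) S-unfit
    where
    S⊆T : S ⊆ proj₁ (scan c P (ord j))
    S⊆T = scan-nothing c P (ord j) e ∘ S⊆ord j

  record Round (j : ℕ) (P : Subset n) : Set where
    field
      pivot      : Fin n
      stops      : proj₂ (scan c P (ord j)) ≡ just pivot
      pivot∈S    : pivot ∈ S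
      pivot∉P    : ¬ pivot ∈ P
      telescopes : 1ℚ + totalCost c P ≤ totalCost c (proj₁ (scan c P (ord j))) + totalCost c (P ∪ ⁅ pivot ⁆)

  round : ∀ j {P} → Fits c P → Round j P
  round j {P} P-fits = record
    { pivot      = u
    ; stops      = stops
    ; pivot∈S    = ord⊆S j (proj₁ (scan-just c P (ord j) stops))
    ; pivot∉P    = u∉P
    ; telescopes = begin
        1ℚ + totalCost c P
          ≤⟨ +-monoˡ-≤ (totalCost c P) (overflow⇒1≤totalCost c c≥0 u∉Tⱼ overflow) ⟩
        (totalCost c Tⱼ + totalCost c ⁅ u ⁆) + totalCost c P
          ≡⟨ xy∙z≈x∙zy (totalCost c Tⱼ) _ _ ⟩
        totalCost c Tⱼ + (totalCost c P + totalCost c ⁅ u ⁆)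
          ≡⟨ cong (_+_ (totalCost c Tⱼ)) (totalCost-∪ c (disjoint-⁅⁆ u∉P)) ⟨
        totalCost c Tⱼ + totalCost c (P ∪ ⁅ u ⁆)
          ∎
    }
    where
    open ≤-Reasoning
    Tⱼ = proj₁ (scan c P (ord j))
    u = proj₁ (scan-stops j P-fits)
    stops = proj₂ (scan-stops j P-fits)
    overflow = proj₂ (proj₂ (scan-just c P (ord j) stops))
    u∉Tⱼ = overflow⇒∉ c c≥0 (scan-fits c P (ord j) P-fits) overflow
    u∉P = u∉Tⱼ ∘ scan-⊇ c P (ord j)

  Feasible : Subset n → Set
  Feasible T = T ⊆ S × Fits c T

  rounds-feasible : ∀ k j {P} → Room k P → All Feasible (rounds c ord (suc k) j P)
  rounds-feasible k j {P} room = subst (All Feasible) (sym (rounds-just c ord stops)) (Tⱼ-feasible ∷ later k room)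
    where
    P-fits = room⇒Fits {k} room
    open Round (round j {P} P-fits)
    Tⱼ-feasible : Feasible (proj₁ (scan c P (ord j)))
    Tⱼ-feasible = scan-⊆ c P (ord j) (proj₁ room) (ord⊆S j) , scan-fits c P (ord j) P-fits
    later : ∀ k → Room k P → All Feasible (rounds c ord k (suc j) (P ∪ ⁅ pivot ⁆))
    later zero    _    = []
    later (suc k) room = rounds-feasible k (suc j) (room-∪-⁅⁆ {k} room pivot∈S pivot∉P)

  rounds-total : ∀ k j {P} → Room k P →
                 k · 1ℚ + totalCost c P ≤ sumℚ (map (totalCost c) (rounds c ord (suc k) j P))
  rounds-total k j {P} room = begin
    k · 1ℚ + totalCost c P                              ≤⟨ later k room ⟩
    totalCost c Tⱼ + Σ (rounds c ord k (suc j) P′)      ≡⟨ cong Σ (rounds-just c ord stops) ⟨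
    Σ (rounds c ord (suc k) j P)                        ∎
    where
    open ≤-Reasoning
    open Round (round j {P} (room⇒Fits {k} room))
    Σ = sumℚ ∘ map (totalCost c)
    Tⱼ = proj₁ (scan c P (ord j))
    P′ = P ∪ ⁅ pivot ⁆
    later : ∀ k → Room k P → k · 1ℚ + totalCost c P ≤ totalCost c Tⱼ + Σ (rounds c ord k (suc j) P′)
    later zero _ = begin
      0ℚ + totalCost c P   ≡⟨ +-identityˡ _ ⟩
      totalCost c P        ≤⟨ totalCost-mono c c≥0 (scan-⊇ c P (ord j)) ⟩
      totalCost c Tⱼ       ≡⟨ +-identityʳ _ ⟨
      totalCost c Tⱼ + 0ℚ  ∎
    later (suc k) room = begin
      (1ℚ + k · 1ℚ) + totalCost c P                ≡⟨ xy∙z≈y∙xz 1ℚ (k · 1ℚ) (totalCost c P) ⟩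
      k · 1ℚ + (1ℚ + totalCost c P)                ≤⟨ +-monoʳ-≤ (k · 1ℚ) telescopes ⟩
      k · 1ℚ + (totalCost c Tⱼ + totalCost c P′)   ≡⟨ x∙yz≈y∙xz (k · 1ℚ) (totalCost c Tⱼ) (totalCost c P′) ⟩
      totalCost c Tⱼ + (k · 1ℚ + totalCost c P′)   ≤⟨ +-monoʳ-≤ (totalCost c Tⱼ) (rounds-total k (suc j) P′-room) ⟩
      totalCost c Tⱼ + Σ (rounds c ord (suc k) (suc j) P′) ∎
      where P′-room = room-∪-⁅⁆ {k} room pivot∈S pivot∉P

lemma9 : ∀ {n d : ℕ} (lam : ℕ) .{{_ : NonZero lam}}
           (c : Fin d → Fin n → ℚ) (S : Subset n) (ord : ℕ → List (Fin n)) →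
           (∀ j → Enumerates S (ord j)) →
           (∀ i u → 0ℚ ≤ c i u) →
           ∃ (λ i → 1ℚ < cost c i S) →
           (∀ i u → u ∈ S → c i u ≤ (+ 1) / lam) →
           ∀ T → T ∈ₗ candidates c ord lam →
           (∀ T′ → T′ ∈ₗ candidates c ord lam → totalCost c T′ ≤ totalCost c T) →
           (T ⊆ S) × (∀ i → cost c i T ≤ 1ℚ) × ((+ lam) / suc lam ≤ totalCost c T)
lemma9 lam c S ord ord-enumerates c≥0 S-overflows c≤ε T T∈ T-max =
  proj₁ T-feasible , proj₂ T-feasible , ·-cancelʳ-≤ (suc lam) (begin
    suc lam · (+ lam / suc lam)                      ≡⟨ ·-/-cancel (suc lam) lam ⟩
    lam · 1ℚ                                         ≡⟨ +-identityʳ (lam · 1ℚ) ⟨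
    lam · 1ℚ + 0ℚ                                    ≤⟨ +-monoʳ-≤ (lam · 1ℚ) (totalCost-nonNeg c c≥0 ⊥) ⟩
    lam · 1ℚ + totalCost c ⊥                         ≤⟨ rounds-total lam 1 room-⊥ ⟩
    sumℚ (map (totalCost c) (candidates c ord lam))  ≤⟨ sumℚ-map-≤-length· (All.tabulate (T-max _)) ⟩
    length (candidates c ord lam) · totalCost c T    ≡⟨ cong (_· totalCost c T) (length-rounds c ord (suc lam) 1 ⊥) ⟩
    suc lam · totalCost c T                          ∎)
  where
  open SetExtract lam c S ord ord-enumerates c≥0 S-overflows c≤ε
  open ≤-Reasoning
  T-feasible = All.lookup (rounds-feasible lam 1 room-⊥) T∈
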